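{- Let $n$ be a positive integer and let $G_{3,n}$ be any graph of the form described in the context (with $j=3$). For every $w\in\left[\frac12,1\right)$, the $w$-power index process on $G_{3,n}$ with initial configuration \[C_0(v)=\begin{cases} D & v\in K_3,\\ C & \text{otherwise}\end{cases}\] is defector dominant.
   Context: All graphs are finite and simple. A configuration of a graph $G$ is a map $C:V(G)\to\{C,D\}$; vertices with value $C$ are collaborators, those with value $D$ defectors. $N[v]$ is the closed neighbourhood of $v$, $N_C[v]$ is the set of collaborators in $N[v]$ and $N_D[v]$ the set of defectors in $N[v]$. Fix a win condition $w\in\left[\frac12,1\right)$. The power of $v$ with respect to a configuration is: if $v$ is a collaborator, $p(v)=1/|N_C[v]|$ when $|N_C[v]|/|N[v]|>w$ and $p(v)=0$ otherwise; if $v$ is a defector, $p(v)=1/|N_D[v]|$ when $|N_C[v]|/|N[v]|\le w$ and $p(v)=0$ otherwise. The $w$-power index process with initial configuration $C_0$ produces configurations $C_1,C_2,\dots$: for $t\ge1$ each vertex $v$ simultaneously takes the strategy that, in $C_{t-1}$, is held by the vertex of $N[v]$ of greatest power (powers computed with respect to $C_{t-1}$); if the vertices of $N[v]$ of greatest power have differing strategies, then $C_t(v)=C_{t-1}(v)$. The process (or $C_0$) is defector dominant if there is $i\ge0$ with $C_i=C_{i+1}$ and $C_i(v)=D$ for every vertex $v$. The graph $G_{j,n}$ (here $j=3$): take the disjoint union of $n+1$ cliques $K_j,K_{2j},K_{2^2j},\dots,K_{2^nj}$ and add edges only between successive cliques so that each vertex of $K_j$ has exactly two neighbours in $K_{2j}$;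 for $1\le i\le n-1$ each vertex of $K_{2^ij}$ has exactly two neighbours in $K_{2^{i+1}j}$ and exactly one neighbour in $K_{2^{i-1}j}$; and each vertex of $K_{2^nj}$ has exactly one neighbour in $K_{2^{n-1}j}$. -}

module Defs where

open import Data.Bool using (Bool; true; false; _∧_; _∨_; not; if_then_else_)
open import Data.Nat as ℕ using (ℕ; zero; suc; _≤_; _<_; _^_; _≡ᵇ_)
open import Data.Fin using (Fin) renaming (zero to fzero; suc to fsuc)
import Data.Fin as Fin
open import Data.Integer using (+_)
open import Data.Rational as ℚ using (ℚ; 0ℚ; 1ℚ; ½; _/_; _⊔_)
import Data.Rational.Properties as ℚP
open import Data.Product using (Σ; ∃; _×_; _,_)
open import Data.Sum using (_⊎_)
open import Relation.Binary.PropositionalEquality using (_≡_; _≢_)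
open import Relation.Nullary.Decidable using (⌊_⌋)
open import Function using (_∘_)

countFin : ∀ {m} → (Fin m → Bool) → ℕ
countFin {zero}  P = 0
countFin {suc m} P = (if P fzero then 1 else 0) ℕ.+ countFin (P ∘ fsuc)

anyFin : ∀ {m} → (Fin m → Bool) → Bool
anyFin {zero}  P = false
anyFin {suc m} P = P fzero ∨ anyFin (P ∘ fsuc)

-- maximum of f over the u with P u (0 if none)
maxFin : ∀ {m} → (Fin m → Bool) → (Fin m → ℚ) → ℚ
maxFin {zero}  P f = 0ℚ
maxFin {suc m} P f =
  (if P fzero then f fzero else 0ℚ) ⊔ maxFin (P ∘ fsuc) (f ∘ fsuc)

record Graph : Set where
  field
    size  : ℕ
    adj   : Fin size → Fin size → Bool
    sym   : ∀ u v → adj u v ≡ adj v u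
    irrefl : ∀ v → adj v v ≡ false

open Graph public

inN : (G : Graph) → Fin (size G) → Fin (size G) → Bool
inN G v u = ⌊ v Fin.≟ u ⌋ ∨ adj G v u

-- Win conditions w ∈ [1/2, 1), with w an arbitrary real number.
-- A real w is represented by its (Boolean-valued) upper Dedekind cut
-- above q ⇔ w < q. Roundedness makes it the strict cut {q | q > w}.

record WinCondition : Set where
  field
    above      : ℚ → Bool
    upClosed   : ∀ q r → above q ≡ true → q ℚ.≤ r → above r ≡ true
    rounded    : ∀ q → above q ≡ true → ∃ λ r → r ℚ.< q × above r ≡ true
    -- w ≥ 1/2 : every q > w satisfies q > 1/2
    geHalf     : ∀ q → above q ≡ true → ½ ℚ.< q
    ltOne      : above 1ℚ ≡ true

open WinCondition public

data Strategy : Set where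
  C D : Strategy

isC : Strategy → Bool
isC C = true
isC D = false

Config : Graph → Set
Config G = Fin (size G) → Strategy

-- a / b as a rational (b = 0 never occurs in use)
frac : ℕ → ℕ → ℚ
frac a zero    = 0ℚ
frac a (suc b) = + a / suc b

-- 1 / k (k = 0 never occurs in use)
inv : ℕ → ℚ
inv zero    = 0ℚ
inv (suc k) = + 1 / suc k

degN : (G : Graph) → Fin (size G) → ℕ
degN G v = countFin (inN G v)

numC : (G : Graph) → Config G → Fin (size G) → ℕ
numC G c v = countFin (λ u → inN G v u ∧ isC (c u))

numD : (G : Graph) → Config G → Fin (size G) → ℕ
numD G c v = countFin (λ u → inN G v u ∧ not (isC (c u)))

wins : (w : WinCondition) (G : Graph) → Config G → Fin (size G) → Bool
wins w G c v = above w (frac (numC G c v) (degN G v))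

power : (w : WinCondition) (G : Graph) → Config G → Fin (size G) → ℚ
power w G c v with c v
... | C = if wins w G c v then inv (numC G c v) else 0ℚ
... | D = if wins w G c v then 0ℚ else inv (numD G c v)

step : (w : WinCondition) (G : Graph) → Config G → Config G
step w G c v =
  let p    = power w G c
      best = maxFin (inN G v) p
      isBest : Fin (size G) → Bool
      isBest u = inN G v u ∧ ⌊ p u ℚP.≟ best ⌋
      hasC = anyFin (λ u → isBest u ∧ isC (c u))
      hasD = anyFin (λ u → isBest u ∧ not (isC (c u)))
  in if hasC ∧ not hasD then C
     else if hasD ∧ not hasC then D
     else c v

iter : (w : WinCondition) (G : Graph) → Config G → ℕ → Config G
iter w G c zero    = c
iter w G c (suc t) = step w G (iter w G c t)

DefectorDominant : (w : WinCondition) (G : Graph) → Config G → Set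
DefectorDominant w G c0 =
  ∃ λ i → (∀ v → iter w G c0 i v ≡ iter w G c0 (suc i) v)
        × (∀ v → iter w G c0 i v ≡ D)

-- G has the form G_{3,n}: its vertex set is partitioned into cliques
-- K_{3·2^i} (i = 0..n), given by the level map, with the prescribed
-- edges between successive cliques and no other edges.

record IsG3 (n : ℕ) (G : Graph) : Set where
  field
    level      : Fin (size G) → ℕ
    levelBound : ∀ v → level v ≤ n
    cliqueSize : ∀ i → i ≤ n → countFin (λ v → level v ≡ᵇ i) ≡ 3 ℕ.* 2 ^ i
    clique     : ∀ u v → u ≢ v → level u ≡ level v → adj G u v ≡ true
    successive : ∀ u v → adj G u v ≡ true →
                 level u ≡ level v ⊎ level v ≡ suc (level u) ⊎ level u ≡ suc (level v)
    twoUp      : ∀ v → level v < n →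
                 countFin (λ u → adj G v u ∧ (level u ≡ᵇ suc (level v))) ≡ 2
    oneDown    : ∀ v → 0 < level v →
                 countFin (λ u → adj G v u ∧ (suc (level u) ≡ᵇ level v)) ≡ 1

open IsG3 public

initConfig : ∀ {n} (G : Graph) → IsG3 n G → Config G
initConfig G s v with level s v
... | zero  = D
... | suc _ = C

-- Write L v for the level of v, i.e. the index i of its clique K_{3·2^i}.
-- We show that the configuration C_t of the process is the "threshold
-- configuration" in which exactly the vertices of level ≤ t defect.  Hence
-- C_n = C_{n+1} is all-defector, which is defector dominance.
--
-- In the threshold configuration
-- a defector d of level t (the frontier) has at most 2 collaborating
-- neighbours and between 3·2^t and 3·2^t + 1 defecting ones (its clique plus
-- at most one vertex below).  So d is in the minority, loses (w ≥ 1/2), and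
-- has power 1/|N_D[d]| > 0, whereas every collaborator u has at least
-- 3·2^(t+1) > 3·2^t + 1 collaborating neighbours (its clique) and so power
-- below that of d.  Consequently every vertex with d in its closed
-- neighbourhood (levels t and t+1) defects next; the other vertices only see
-- their own strategy and keep it.

module Submission where

open import Defs
open import Data.Nat using (ℕ; _<_)

open import Data.Bool using (Bool; true; false; _∧_; _∨_; not; if_then_else_)
open import Data.Bool.Properties using (∧-conicalˡ; ∧-conicalʳ; T-≡)
open import Data.Nat using (zero; suc; _≤_; _+_; _*_; _^_; _≡ᵇ_; z≤n; s≤s; _≤?_; _<?_)
import Data.Nat.Properties as ℕP
open import Data.Fin using (Fin) renaming (zero to fzero; suc to fsuc)
import Data.Fin as Fin
open import Data.Integer using (+_; +≤+; +<+)
import Data.Integer as ℤ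
import Data.Integer.Properties as ℤP
open import Data.Rational using (ℚ; 0ℚ; ½; _/_)
import Data.Rational as ℚ
import Data.Rational.Properties as ℚP
import Data.Rational.Unnormalised as U
import Data.Rational.Unnormalised.Properties as UP
open import Data.Product using (∃; _×_; _,_)
open import Data.Sum using (_⊎_; inj₁; inj₂)
open import Data.Empty using (⊥-elim)
open import Function using (_∘_)
open import Function.Bundles using (Equivalence)
open import Relation.Binary using (tri<; tri≈; tri>)
open import Relation.Binary.PropositionalEquality
  using (_≡_; _≢_; refl; trans; cong; cong₂; subst; subst₂)
  renaming (sym to ≡-sym)
open import Relation.Nullary using (Dec; yes; no)
open import Relation.Nullary.Decidable using (⌊_⌋)

isYes-sound : {A : Set} (a? : Dec A) → ⌊ a? ⌋ ≡ true → A
isYes-sound (yes a) _ = a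

isYes-complete : {A : Set} (a? : Dec A) → A → ⌊ a? ⌋ ≡ true
isYes-complete (yes _) _ = refl
isYes-complete (no ¬a) a = ⊥-elim (¬a a)

≡ᵇ-sound : ∀ {m k} → (m ≡ᵇ k) ≡ true → m ≡ k
≡ᵇ-sound {m} {k} e = ℕP.≡ᵇ⇒≡ m k (Equivalence.from T-≡ e)

≡ᵇ-complete : ∀ {m k} → m ≡ k → (m ≡ᵇ k) ≡ true
≡ᵇ-complete {m} {k} e = Equivalence.to T-≡ (ℕP.≡⇒≡ᵇ m k e)

∧-intro : ∀ {a b} → a ≡ true → b ≡ true → a ∧ b ≡ true
∧-intro refl refl = refl

false≢true : false ≢ true
false≢true ()

∨-introˡ : ∀ {a b} → a ≡ true → a ∨ b ≡ true
∨-introˡ refl = refl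

∨-introʳ : ∀ {a b} → b ≡ true → a ∨ b ≡ true
∨-introʳ {true}  _ = refl
∨-introʳ {false} e = e

∨-resolve : ∀ a b → a ∨ b ≡ true → not a ≡ true → b ≡ true
∨-resolve false b e _ = e

collaborates : ∀ {s} → isC s ≡ true → s ≡ C
collaborates {C} _ = refl

defects : ∀ {s} → not (isC s) ≡ true → s ≡ D
defects {D} _ = refl

non-collaborator : ∀ {s} → s ≢ C → not (isC s) ≡ true
non-collaborator {C} s≢C = ⊥-elim (s≢C refl)
non-collaborator {D} _   = refl

countFin-mono : ∀ {m} (P Q : Fin m → Bool) → (∀ x → P x ≡ true → Q x ≡ true) →
                countFin P ≤ countFin Q
countFin-mono {zero}  P Q f = z≤n
countFin-mono {suc m} P Q f with P fzero in eP | Q fzero in eQ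
... | true  | true  = s≤s (countFin-mono _ _ (f ∘ fsuc))
... | true  | false with () ← trans (≡-sym (f fzero eP)) eQ
... | false | true  = ℕP.m≤n⇒m≤1+n (countFin-mono _ _ (f ∘ fsuc))
... | false | false = countFin-mono _ _ (f ∘ fsuc)

countFin-none : ∀ {m} (P : Fin m → Bool) → (∀ x → P x ≢ true) → countFin P ≡ 0
countFin-none {zero}  P f = refl
countFin-none {suc m} P f with P fzero in eP
... | true  = ⊥-elim (f fzero eP)
... | false = countFin-none _ (f ∘ fsuc)

countFin-positive : ∀ {m} (P : Fin m → Bool) x → P x ≡ true → 0 < countFin P
countFin-positive P fzero    e rewrite e = s≤s z≤n
countFin-positive P (fsuc x) e with P fzero
... | true  = s≤s z≤n
... | false = countFin-positive _ x e

countFin-witness : ∀ {m} (P : Fin m → Bool) → 0 < countFin P → ∃ λ x → P x ≡ true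
countFin-witness {suc m} P h with P fzero in eP
... | true  = fzero , eP
... | false with countFin-witness _ h
...   | x , e = fsuc x , e

countFin-split : ∀ {m} (P Q : Fin m → Bool) →
  countFin P ≡ countFin (λ x → P x ∧ Q x) + countFin (λ x → P x ∧ not (Q x))
countFin-split {zero}  P Q = refl
countFin-split {suc m} P Q with P fzero | Q fzero
... | false | _     = countFin-split (P ∘ fsuc) (Q ∘ fsuc)
... | true  | true  = cong suc (countFin-split (P ∘ fsuc) (Q ∘ fsuc))
... | true  | false = trans (cong suc (countFin-split (P ∘ fsuc) (Q ∘ fsuc)))
                            (≡-sym (ℕP.+-suc _ _))

countFin-cover : ∀ {m} (P Q R : Fin m → Bool) → (∀ x → P x ≡ true → Q x ∨ R x ≡ true) →
                 countFin P ≤ countFin Q + countFin R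
countFin-cover P Q R cover = ℕP.≤-trans (ℕP.≤-reflexive (countFin-split P Q))
  (ℕP.+-mono-≤ (countFin-mono _ Q λ x e → ∧-conicalʳ _ _ e)
               (countFin-mono _ R λ x e →
                  ∨-resolve _ _ (cover x (∧-conicalˡ _ _ e)) (∧-conicalʳ _ _ e)))

anyFin-witness : ∀ {m} (P : Fin m → Bool) x → P x ≡ true → anyFin P ≡ true
anyFin-witness P fzero    e rewrite e = refl
anyFin-witness P (fsuc x) e with P fzero
... | true  = refl
... | false = anyFin-witness _ x e

anyFin-none : ∀ {m} (P : Fin m → Bool) → (∀ x → P x ≢ true) → anyFin P ≡ false
anyFin-none {zero}  P f = refl
anyFin-none {suc m} P f with P fzero in eP
... | true  = ⊥-elim (f fzero eP)
... | false = anyFin-none _ (f ∘ fsuc)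

maxFin-upper : ∀ {m} (P : Fin m → Bool) (f : Fin m → ℚ) x → P x ≡ true →
               f x ℚ.≤ maxFin P f
maxFin-upper P f fzero    e rewrite e = ℚP.p≤p⊔q _ _
maxFin-upper P f (fsuc x) e = ℚP.≤-trans (maxFin-upper (P ∘ fsuc) (f ∘ fsuc) x e)
                                         (ℚP.p≤q⊔p (if P fzero then f fzero else 0ℚ) _)

maxFin-attained : ∀ {m} (P : Fin m → Bool) (f : Fin m → ℚ) →
  maxFin P f ≡ 0ℚ ⊎ ∃ λ x → P x ≡ true × f x ≡ maxFin P f
maxFin-attained {zero} P f = inj₁ refl
maxFin-attained {suc m} P f
  with P fzero in eP | maxFin-attained (P ∘ fsuc) (f ∘ fsuc)
     | ℚP.⊔-sel (if P fzero then f fzero else 0ℚ) (maxFin (P ∘ fsuc) (f ∘ fsuc))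
... | true  | _                  | inj₁ e = inj₂ (fzero , eP , ≡-sym e)
... | false | _                  | inj₁ e = inj₁ e
... | _     | inj₁ z             | inj₂ e = inj₁ (trans e z)
... | _     | inj₂ (x , px , fx) | inj₂ e = inj₂ (fsuc x , px , trans fx (≡-sym e))

frac-≤ : ∀ a b c d → a * suc d ≤ c * suc b → (+ a / suc b) ℚ.≤ (+ c / suc d)
frac-≤ a b c d h = ℚP.toℚᵘ-cancel-≤
  (UP.≤-respˡ-≃ (UP.≃-sym (ℚP.toℚᵘ-fromℚᵘ (U.mkℚᵘ (+ a) b)))
  (UP.≤-respʳ-≃ (UP.≃-sym (ℚP.toℚᵘ-fromℚᵘ (U.mkℚᵘ (+ c) d))) (U.*≤* cross)))
  where
  cross : + a ℤ.* + suc d ℤ.≤ + c ℤ.* + suc b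
  cross rewrite ≡-sym (ℤP.pos-* a (suc d)) | ≡-sym (ℤP.pos-* c (suc b)) = +≤+ h

frac-< : ∀ a b c d → a * suc d < c * suc b → (+ a / suc b) ℚ.< (+ c / suc d)
frac-< a b c d h = ℚP.toℚᵘ-cancel-<
  (UP.<-respˡ-≃ (UP.≃-sym (ℚP.toℚᵘ-fromℚᵘ (U.mkℚᵘ (+ a) b)))
  (UP.<-respʳ-≃ (UP.≃-sym (ℚP.toℚᵘ-fromℚᵘ (U.mkℚᵘ (+ c) d))) (U.*<* cross)))
  where
  cross : + a ℤ.* + suc d ℤ.< + c ℤ.* + suc b
  cross rewrite ≡-sym (ℤP.pos-* a (suc d)) | ≡-sym (ℤP.pos-* c (suc b)) = +<+ h

inv-positive : ∀ k → 0 < k → 0ℚ ℚ.< inv k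
inv-positive (suc k) _ = frac-< 0 0 1 k (s≤s z≤n)

inv-nonnegative : ∀ k → 0ℚ ℚ.≤ inv k
inv-nonnegative zero    = ℚP.≤-refl
inv-nonnegative (suc k) = ℚP.<⇒≤ (inv-positive (suc k) (s≤s z≤n))

inv-antitone : ∀ m k → 0 < m → m < k → inv k ℚ.< inv m
inv-antitone (suc m) (suc k) _ h =
  frac-< 1 k 1 m (subst₂ _<_ (≡-sym (ℕP.*-identityˡ (suc m))) (≡-sym (ℕP.*-identityˡ (suc k))) h)

frac-≤½ : ∀ a b → 2 * a ≤ b → 0 < b → frac a b ℚ.≤ ½
frac-≤½ a (suc b) h _ =
  frac-≤ a b 1 1 (subst (a * 2 ≤_) (≡-sym (ℕP.*-identityˡ _))
                   (subst (_≤ suc b) (ℕP.*-comm 2 a) h))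

module _ (G : Graph) where

  inN-refl : ∀ v → inN G v v ≡ true
  inN-refl v = cong (_∨ adj G v v) (isYes-complete (v Fin.≟ v) refl)

  inN-adj : ∀ {v u} → adj G v u ≡ true → inN G v u ≡ true
  inN-adj = ∨-introʳ

  inN-cases : ∀ {v u} → inN G v u ≡ true → v ≡ u ⊎ adj G v u ≡ true
  inN-cases {v} {u} e with v Fin.≟ u
  ... | yes p = inj₁ p
  ... | no _  = inj₂ e

verdict : Bool → Bool → Strategy → Strategy
verdict hasC hasD x = if hasC ∧ not hasD then C else if hasD ∧ not hasC then D else x

verdict-keeps : ∀ hasC hasD x → (x ≡ C → hasD ≡ false) → (x ≡ D → hasC ≡ false) →
                verdict hasC hasD x ≡ x
verdict-keeps true  _    C noD _ rewrite noD refl = refl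
verdict-keeps false _    C noD _ rewrite noD refl = refl
verdict-keeps _    true  D _ noC rewrite noC refl = refl
verdict-keeps _    false D _ noC rewrite noC refl = refl

-- The quantities p, best and isBest below are exactly those inside `step`,
-- so `step w G c v` unfolds definitionally to a verdict on their flags.
module Step (w : WinCondition) (G : Graph) (c : Config G) (v : Fin (size G)) where

  p : Fin (size G) → ℚ
  p = power w G c

  best : ℚ
  best = maxFin (inN G v) p

  isBest : Fin (size G) → Bool
  isBest u = inN G v u ∧ ⌊ p u ℚP.≟ best ⌋

  noBestWith : (Q : Strategy → Bool) → (∀ u → inN G v u ≡ true → Q (c u) ≡ false) →
               anyFin (λ u → isBest u ∧ Q (c u)) ≡ false
  noBestWith Q excluded = anyFin-none _ λ u e →
    false≢true (trans (≡-sym (excluded u (∧-conicalˡ _ _ (∧-conicalˡ _ _ e)))) (∧-conicalʳ _ _ e))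

  step-unanimous : ∀ s → (∀ u → inN G v u ≡ true → c u ≡ s) → step w G c v ≡ s
  step-unanimous s agree = trans
    (verdict-keeps _ _ (c v)
      (λ vC → noBestWith (not ∘ isC) λ u i → cong (not ∘ isC) (trans (agree u i) (trans (≡-sym own) vC)))
      (λ vD → noBestWith isC λ u i → cong isC (trans (agree u i) (trans (≡-sym own) vD))))
    own
    where
    own : c v ≡ s
    own = agree v (inN-refl G v)

  step-defects : ∀ d → inN G v d ≡ true → 0ℚ ℚ.< p d →
                 (∀ u → inN G v u ≡ true → c u ≡ C → p u ℚ.< p d) → step w G c v ≡ D
  step-defects d vd d-positive d-beats = cong₂ (λ hc hd → verdict hc hd (c v)) noBestC someBestD
    where
    d≤best : p d ℚ.≤ best
    d≤best = maxFin-upper (inN G v) p d vd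

    notBest : ∀ u → inN G v u ≡ true → c u ≡ C → p u ≢ best
    notBest u i uC eq = ℚP.<-irrefl eq (ℚP.<-≤-trans (d-beats u i uC) d≤best)

    noBestC : anyFin (λ u → isBest u ∧ isC (c u)) ≡ false
    noBestC = anyFin-none _ λ u e →
      let best-u = ∧-conicalˡ _ _ e
      in notBest u (∧-conicalˡ _ _ best-u) (collaborates (∧-conicalʳ _ _ e))
                   (isYes-sound (p u ℚP.≟ best) (∧-conicalʳ _ _ best-u))

    someBestD : anyFin (λ u → isBest u ∧ not (isC (c u))) ≡ true
    someBestD with maxFin-attained (inN G v) p
    ... | inj₁ best≡0 =
      ⊥-elim (ℚP.<-irrefl refl (ℚP.<-≤-trans d-positive (subst (p d ℚ.≤_) best≡0 d≤best)))
    ... | inj₂ (x , vx , px) = anyFin-witness _ x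
      (∧-intro (∧-intro vx (isYes-complete (p x ℚP.≟ best) px)) (non-collaborator λ xC → notBest x vx xC px))

module Power (w : WinCondition) (G : Graph) (c : Config G) where

  degN-split : ∀ v → degN G v ≡ numC G c v + numD G c v
  degN-split v = countFin-split (inN G v) (λ u → isC (c u))

  -- a defector counts itself among its defecting neighbours
  numD-positive : ∀ d → c d ≡ D → 0 < numD G c d
  numD-positive d dD = countFin-positive _ d
    (∧-intro (inN-refl G d) (cong (not ∘ isC) dD))

  minority-loses : ∀ d → 2 * numC G c d ≤ degN G d → wins w G c d ≡ false
  minority-loses d minority with wins w G c d in won
  ... | false = refl
  ... | true  = ⊥-elim (ℚP.<-irrefl refl (ℚP.<-≤-trans (geHalf w _ won)
                  (frac-≤½ _ _ minority (countFin-positive _ d (inN-refl G d)))))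

  defector-power : ∀ d → c d ≡ D → wins w G c d ≡ false → power w G c d ≡ inv (numD G c d)
  defector-power d _ lost with c d
  ... | D rewrite lost = refl

  collaborator-power≤ : ∀ u → c u ≡ C → power w G c u ℚ.≤ inv (numC G c u)
  collaborator-power≤ u _ with c u
  ... | C with wins w G c u
  ...   | true  = ℚP.≤-refl
  ...   | false = inv-nonnegative (numC G c u)

  minority-defector : ∀ d → c d ≡ D → 2 * numC G c d ≤ degN G d →
    0ℚ ℚ.< power w G c d ×
    (∀ u → c u ≡ C → numD G c d < numC G c u → power w G c u ℚ.< power w G c d)
  minority-defector d dD minority =
    subst (0ℚ ℚ.<_) (≡-sym d-power) (inv-positive _ (numD-positive d dD)) ,
    λ u uC crowded → subst (power w G c u ℚ.<_) (≡-sym d-power)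
      (ℚP.≤-<-trans (collaborator-power≤ u uC)
                    (inv-antitone _ _ (numD-positive d dD) crowded))
    where
    d-power : power w G c d ≡ inv (numD G c d)
    d-power = defector-power d dD (minority-loses d minority)

threshold : ℕ → ℕ → Strategy
threshold t l with l ≤? t
... | yes _ = D
... | no  _ = C

threshold-D : ∀ {t l} → l ≤ t → threshold t l ≡ D
threshold-D {t} {l} h with l ≤? t
... | yes _ = refl
... | no  ¬h = ⊥-elim (¬h h)

threshold-C : ∀ {t l} → t < l → threshold t l ≡ C
threshold-C {t} {l} h with l ≤? t
... | yes le = ⊥-elim (ℕP.<⇒≱ h le)
... | no  _  = refl

threshold-C⁻¹ : ∀ {t l} → threshold t l ≡ C → t < l
threshold-C⁻¹ {t} {l} e with l ≤? t
... | no ¬le = ℕP.≰⇒> ¬le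

threshold-D⁻¹ : ∀ {t l} → threshold t l ≡ D → l ≤ t
threshold-D⁻¹ {t} {l} e with l ≤? t
... | yes le = le

module OnG3 (n : ℕ) (G : Graph) (s : IsG3 n G) (w : WinCondition) where

  L : Fin (size G) → ℕ
  L = level s

  neighbour-levels : ∀ {v u} → inN G v u ≡ true →
                     L v ≡ L u ⊎ L u ≡ suc (L v) ⊎ L v ≡ suc (L u)
  neighbour-levels {v} {u} e with inN-cases G e
  ... | inj₁ refl = inj₁ refl
  ... | inj₂ a    = successive s v u a

  neighbour-below : ∀ {v u} → inN G v u ≡ true → L u ≤ suc (L v)
  neighbour-below e with neighbour-levels e
  ... | inj₁ q        = ℕP.≤-trans (ℕP.≤-reflexive (≡-sym q)) (ℕP.n≤1+n _)
  ... | inj₂ (inj₁ q) = ℕP.≤-reflexive q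
  ... | inj₂ (inj₂ q) = ℕP.m≤n⇒m≤1+n (ℕP.≤-trans (ℕP.n≤1+n _) (ℕP.≤-reflexive (≡-sym q)))

  neighbour-above : ∀ {v u} → inN G v u ≡ true → L v ≤ suc (L u)
  neighbour-above e with neighbour-levels e
  ... | inj₁ q        = ℕP.≤-trans (ℕP.≤-reflexive q) (ℕP.n≤1+n _)
  ... | inj₂ (inj₁ q) = ℕP.m≤n⇒m≤1+n (ℕP.≤-trans (ℕP.n≤1+n _) (ℕP.≤-reflexive (≡-sym q)))
  ... | inj₂ (inj₂ q) = ℕP.≤-reflexive q

  inN-sameLevel : ∀ {v u} → L u ≡ L v → inN G v u ≡ true
  inN-sameLevel {v} {u} e with v Fin.≟ u
  ... | yes _  = refl
  ... | no v≢u = clique s v u v≢u (≡-sym e)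

  inN-otherLevel : ∀ {v u} → inN G v u ≡ true → L u ≢ L v → adj G v u ≡ true
  inN-otherLevel e differ with inN-cases G e
  ... | inj₁ refl = ⊥-elim (differ refl)
  ... | inj₂ a    = a

  clique-count : ∀ u (P : Fin (size G) → Bool) → (∀ x → L x ≡ L u → P x ≡ true) →
                 3 * 2 ^ L u ≤ countFin P
  clique-count u P onClique = subst (_≤ countFin P) (cliqueSize s (L u) (levelBound s u))
    (countFin-mono _ P λ x e → onClique x (≡ᵇ-sound e))

  down-degree≤1 : ∀ x → countFin (λ u → adj G x u ∧ (suc (L u) ≡ᵇ L x)) ≤ 1
  down-degree≤1 x with L x in Lx
  ... | zero  = ℕP.≤-trans (ℕP.≤-reflexive
                  (countFin-none (λ u → adj G x u ∧ (suc (L u) ≡ᵇ 0)) λ u e →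
                     ℕP.1+n≢0 {L u} (≡ᵇ-sound (∧-conicalʳ (adj G x u) _ e)))) z≤n
  ... | suc _ = ℕP.≤-reflexive (subst (λ l → countFin (λ u → adj G x u ∧ (suc (L u) ≡ᵇ l)) ≡ 1)
                  Lx (oneDown s x (subst (0 <_) (≡-sym Lx) (s≤s z≤n))))

  down-neighbour : ∀ v → 0 < L v → ∃ λ d → adj G v d ≡ true × suc (L d) ≡ L v
  down-neighbour v positive
    with countFin-witness _ (ℕP.≤-trans (s≤s z≤n) (ℕP.≤-reflexive (≡-sym (oneDown s v positive))))
  ... | d , e = d , ∧-conicalˡ _ _ e , ≡ᵇ-sound (∧-conicalʳ _ _ e)

  AtTime : ℕ → Config G → Set
  AtTime t c = ∀ u → c u ≡ threshold t (L u)

  three≤ : ∀ t → 3 ≤ 3 * 2 ^ t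
  three≤ t = ℕP.*-monoʳ-≤ 3 (ℕP.m^n>0 2 t)

  module Frontier (t : ℕ) (c : Config G) (atTime : AtTime t c) where

    open Power w G c

    collaborator-level : ∀ {u} → c u ≡ C → t < L u
    collaborator-level {u} e = threshold-C⁻¹ (trans (≡-sym (atTime u)) e)

    defector-level : ∀ {u} → c u ≡ D → L u ≤ t
    defector-level {u} e = threshold-D⁻¹ (trans (≡-sym (atTime u)) e)

    -- a collaborator sees its whole (collaborating) clique
    collaborator-crowd : ∀ u → c u ≡ C → 3 * 2 ^ L u ≤ numC G c u
    collaborator-crowd u uC = clique-count u _ λ x same →
      ∧-intro (inN-sameLevel same)
        (cong isC (trans (atTime x) (trans (cong (threshold t) same) (trans (≡-sym (atTime u)) uC))))

    module _ (d : Fin (size G)) (Ld : L d ≡ t) where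

      d-defects : c d ≡ D
      d-defects = trans (atTime d) (threshold-D (ℕP.≤-reflexive Ld))

      collaborators-up : ∀ u → inN G d u ∧ isC (c u) ≡ true →
                         adj G d u ∧ (L u ≡ᵇ suc (L d)) ≡ true
      collaborators-up u e with neighbour-levels (∧-conicalˡ _ _ e)
                              | collaborator-level (collaborates (∧-conicalʳ _ _ e))
      ... | inj₁ q        | above = ⊥-elim (ℕP.<-irrefl refl (subst (t <_) (trans (≡-sym q) Ld) above))
      ... | inj₂ (inj₁ q) | _     = ∧-intro (inN-otherLevel (∧-conicalˡ _ _ e)
                                      (λ r → ℕP.1+n≢n (trans (≡-sym q) r)))
                                      (≡ᵇ-complete q)
      ... | inj₂ (inj₂ q) | above = ⊥-elim (ℕP.<⇒≱ above (ℕP.≤-trans (ℕP.n≤1+n _)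
                                      (ℕP.≤-reflexive (trans (≡-sym q) Ld))))

      few-collaborators : numC G c d ≤ 2
      few-collaborators with L d <? n
      ... | yes below-top = ℕP.≤-trans (countFin-mono _ _ collaborators-up)
                                       (ℕP.≤-reflexive (twoUp s d below-top))
      ... | no  top       = ℕP.≤-trans (ℕP.≤-reflexive (countFin-none _ λ u e →
            top (subst (_≤ n) (≡ᵇ-sound (∧-conicalʳ _ _ (collaborators-up u e))) (levelBound s u)))) z≤n

      -- d's whole clique defects
      many-defectors : 3 * 2 ^ t ≤ numD G c d
      many-defectors = subst (λ l → 3 * 2 ^ l ≤ numD G c d) Ld (clique-count d _ λ x same →
        ∧-intro (inN-sameLevel same)
          (cong (not ∘ isC) (trans (atTime x) (threshold-D (ℕP.≤-reflexive (trans same Ld))))))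

      -- defecting closed neighbours of d: its clique and at most one vertex below
      few-defectors : numD G c d ≤ 3 * 2 ^ t + 1
      few-defectors = ℕP.≤-trans
        (countFin-cover _ (λ u → L u ≡ᵇ t) (λ u → adj G d u ∧ (suc (L u) ≡ᵇ L d)) cover)
        (ℕP.+-mono-≤ (ℕP.≤-reflexive (cliqueSize s t (subst (_≤ n) Ld (levelBound s d))))
                     (down-degree≤1 d))
        where
        cover : ∀ u → inN G d u ∧ not (isC (c u)) ≡ true →
                (L u ≡ᵇ t) ∨ (adj G d u ∧ (suc (L u) ≡ᵇ L d)) ≡ true
        cover u e with neighbour-levels (∧-conicalˡ _ _ e)
                     | defector-level (defects (∧-conicalʳ _ _ e))
        ... | inj₁ q        | _     = ∨-introˡ (≡ᵇ-complete (trans (≡-sym q) Ld))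
        ... | inj₂ (inj₁ q) | below = ⊥-elim (ℕP.<⇒≱ (subst (t <_) (≡-sym (trans q (cong suc Ld))) (ℕP.n<1+n t)) below)
        ... | inj₂ (inj₂ q) | _     = ∨-introʳ (∧-intro
              (inN-otherLevel (∧-conicalˡ _ _ e) (λ r → ℕP.1+n≢n (trans (≡-sym q) (≡-sym r))))
              (≡ᵇ-complete (≡-sym q)))

      -- hence d is in the minority: |N_C[d]| ≤ 2 < 3 ≤ |N_D[d]|
      minority : 2 * numC G c d ≤ degN G d
      minority = subst (2 * numC G c d ≤_) (≡-sym (degN-split d))
        (ℕP.+-monoʳ-≤ (numC G c d) (subst (_≤ numD G c d) (≡-sym (ℕP.+-identityʳ _))
          (ℕP.≤-trans few-collaborators
            (ℕP.≤-trans (ℕP.n≤1+n 2) (ℕP.≤-trans (three≤ t) many-defectors)))))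

      outnumbered : ∀ u → c u ≡ C → numD G c d < numC G c u
      outnumbered u uC = begin-strict
        numD G c d       ≤⟨ few-defectors ⟩
        3 * a + 1        <⟨ ℕP.+-monoʳ-< (3 * a) (ℕP.<-≤-trans (s≤s (s≤s z≤n)) (three≤ t)) ⟩
        3 * a + 3 * a    ≡⟨ ≡-sym (ℕP.*-distribˡ-+ 3 a a) ⟩
        3 * (a + a)      ≡⟨ cong (λ x → 3 * (a + x)) (≡-sym (ℕP.+-identityʳ a)) ⟩
        3 * 2 ^ suc t    ≤⟨ ℕP.*-monoʳ-≤ 3 (ℕP.^-monoʳ-≤ 2 (collaborator-level uC)) ⟩
        3 * 2 ^ L u      ≤⟨ collaborator-crowd u uC ⟩
        numC G c u       ∎
        where
        open ℕP.≤-Reasoning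
        a : ℕ
        a = 2 ^ t

      converts : ∀ v → inN G v d ≡ true → step w G c v ≡ D
      converts v vd with minority-defector d d-defects minority
      ... | d-positive , d-beats = Step.step-defects w G c v d vd d-positive
                                     λ u _ uC → d-beats u uC (outnumbered u uC)

    advance : AtTime (suc t) (step w G c)
    advance v with ℕP.<-cmp (L v) t
    ... | tri< below _ _ = trans
      (Step.step-unanimous w G c v D λ u i →
         trans (atTime u) (threshold-D (ℕP.≤-trans (neighbour-below i) below)))
      (≡-sym (threshold-D (ℕP.m≤n⇒m≤1+n (ℕP.<⇒≤ below))))
    ... | tri≈ _ same _ = trans (converts v same v (inN-refl G v))
                                (≡-sym (threshold-D (ℕP.m≤n⇒m≤1+n (ℕP.≤-reflexive same))))
    ... | tri> _ _ above with ℕP.m≤n⇒m<n∨m≡n above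
    ...   | inj₁ far = trans
      (Step.step-unanimous w G c v C λ u i →
         trans (atTime u) (threshold-C (ℕP.≤-pred (ℕP.<-≤-trans far (neighbour-above i)))))
      (≡-sym (threshold-C far))
    ...   | inj₂ next with down-neighbour v (ℕP.<-≤-trans (s≤s z≤n) above)
    ...     | d , vd , Ld = trans (converts d (ℕP.suc-injective (trans Ld (≡-sym next))) v (inN-adj G vd))
                                  (≡-sym (threshold-D (ℕP.≤-reflexive (≡-sym next))))

  initial : AtTime 0 (initConfig G s)
  initial u with level s u
  ... | zero  = refl
  ... | suc _ = refl

  atTime : ∀ t → AtTime t (iter w G (initConfig G s) t)
  atTime zero    = initial
  atTime (suc t) = Frontier.advance t _ (atTime t)

  all-defect : ∀ t → n ≤ t → ∀ v → iter w G (initConfig G s) t v ≡ D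
  all-defect t n≤t v = trans (atTime t v) (threshold-D (ℕP.≤-trans (levelBound s v) n≤t))

mainTheorem2 : (n : ℕ) → 0 < n → (G : Graph) → (s : IsG3 n G) →
    (w : WinCondition) → DefectorDominant w G (initConfig G s)
mainTheorem2 n _ G s w =
  n , (λ v → trans (all-defect n ℕP.≤-refl v) (≡-sym (all-defect (suc n) (ℕP.n≤1+n n) v)))
    , all-defect n ℕP.≤-refl
  where
  open OnG3 n G s w
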